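{- Let $r$ be a positive integer, let $\epsilon\le 1/10$, and let $B'$ be an $[n]$-way branching program on inputs in $[n]^{2n-1}$ of height $q=\epsilon n$. Let $\pi$ be a source-sink path in $B'$, and let $i_1<\cdots<i_r$ be $r$ $\pi$-unique positions at which $\pi$ produces output values $z_{i_1},\ldots,z_{i_r}$. For $x$ chosen uniformly at random from $[n]^{2n-1}$, $$\Pr\left[z_{i_\ell}=F_0(x_{i_\ell},\ldots,x_{i_\ell+n-1})\text{ for all }\ell\in[r],\ \text{and }\mathcal{E}\ \middle|\ \pi_{B'}(x)=\pi\right]\le(17/18)^r,$$ where $\mathcal{E}$ is the event that $0.5n\le F_0(x_i,\ldots,x_{i+n-1})\le 0.85n$ for all $i\in[n]$.
   Context: $F_0$ of a string is the number of distinct symbols in it. An $[n]$-way branching program is a directed acyclic graph with a source node; each non-sink node is labeled by an input index in $[2n-1]$ and has one out-edge for each value in $[n]$; edges may be labeled with assignments of values $z_i$ to output positions $i\in[n]$ (the intended output at position $i$ being $F_0(x_i,\ldots,x_{i+n-1})$). Its height is the length of its longest path. $\pi_{B'}(x)$ is the path followed on input $x$. For a path $\pi$, $Q_\pi$ is the set of input indices queried along $\pi$ and $A_\pi:Q_\pi\to[n]$ gives the answers along $\pi$ (so $\pi_{B'}(x)=\pi$ iff $x_i=A_\pi(i)$ for all $i\in Q_\pi$). An index $\ell<n$ is $\pi$-unique iff either $\ell\notin Q_\pi$, or $A_\pi(\ell)\notin A_\pi(Q_\pi\setminus\{\ell\})$. -}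

module Defs where

open import Data.Nat using (ℕ; zero; suc; _+_; _*_; _∸_; _≤_; _<_; _≤?_)
import Data.Nat as ℕ
open import Data.Fin using (Fin; zero; suc; toℕ; _≟_)
open import Data.Fin.Properties using (all?)
open import Data.List using (List; []; _∷_; length; filter; take; drop; tabulate; allFin; concatMap; map; deduplicate)
open import Data.List.Properties using () renaming (≡-dec to List-≡-dec)
open import Data.List.Membership.Propositional using (_∈_)
open import Data.List.Relation.Unary.Any using (Any)
open import Data.Maybe using (Maybe; just; nothing)
open import Data.Product using (Σ; ∃; _×_; _,_; proj₁; proj₂)
open import Data.Product.Properties using () renaming (≡-dec to ×-≡-dec)
open import Relation.Binary.PropositionalEquality using (_≡_; _≢_)
open import Relation.Nullary using (Dec; ¬_)
open import Relation.Nullary.Decidable using (_×-dec_)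
open import Relation.Unary using (Decidable)

-- Conventions (0-based): inputs x ∈ [n]^(2n-1) are functions
-- Fin (2n-1) → Fin n; output positions are Fin n, position i
-- (0-based) corresponds to the window x_i … x_{i+n-1}.
-- An output value z ∈ [n] = {1..n} is stored as  z : Fin n  and means
-- the natural number  suc (toℕ z).

Input : ℕ → Set
Input n = Fin (2 * n ∸ 1) → Fin n

F₀ : ∀ {n} → List (Fin n) → ℕ
F₀ xs = length (deduplicate _≟_ xs)

window : ∀ {n} → Input n → Fin n → List (Fin n)
window {n} x i = take n (drop (toℕ i) (tabulate x))

F₀at : ∀ {n} → Input n → Fin n → ℕ
F₀at x i = F₀ (window x i)

-- Nodes are Fin N.  label v = nothing  : v is a sink;
-- label v = just j : v queries input index j, and for each answer a
-- the out-edge goes to  next v a  and carries the partial assignment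
-- out v a : (output position) → Maybe (value).
record BP (n : ℕ) : Set where
  field
    N      : ℕ
    source : Fin N
    label  : Fin N → Maybe (Fin (2 * n ∸ 1))
    next   : Fin N → Fin n → Fin N
    out    : Fin N → Fin n → Fin n → Maybe (Fin n)

open BP public

-- a step of a path: the node left and the answer (edge) taken
Step : ∀ {n} → BP n → Set
Step {n} B = Fin (N B) × Fin n

data Walk {n} (B : BP n) : Fin (N B) → List (Step B) → Set where
  [] : ∀ {v} → Walk B v []
  step : ∀ {v j a ws} → label B v ≡ just j →
         Walk B (next B v a) ws → Walk B v ((v , a) ∷ ws)

-- height ≤ q : every path (from any node) has length ≤ q
-- (this also forces the graph to be acyclic)
HeightAtMost : ∀ {n} → BP n → ℕ → Set
HeightAtMost B q = ∀ v ws → Walk B v ws → length ws ≤ q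

data PathToSink {n} (B : BP n) : Fin (N B) → List (Step B) → Set where
  done : ∀ {v} → label B v ≡ nothing → PathToSink B v []
  step : ∀ {v j a ws} → label B v ≡ just j →
         PathToSink B (next B v a) ws → PathToSink B v ((v , a) ∷ ws)

SourceSinkPath : ∀ {n} (B : BP n) → List (Step B) → Set
SourceSinkPath B π = PathToSink B (source B) π

-- the computation path followed on input x (fuel = number of nodes,
-- which suffices in a DAG)
run : ∀ {n} (B : BP n) → Input n → ℕ → Fin (N B) → List (Step B)
run B x zero v = []
run B x (suc f) v with label B v
... | nothing = []
... | just j  = (v , x j) ∷ run B x f (next B v (x j))

πB : ∀ {n} (B : BP n) → Input n → List (Step B)
πB B x = run B x (N B) (source B)

-- ℓ is π-unique: every answer at a step querying index ℓ differs from
-- every answer at a step querying an index ≠ ℓ (vacuous if ℓ ∉ Q_π)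
PiUnique : ∀ {n} (B : BP n) → List (Step B) → ℕ → Set
PiUnique B π ℓ = ∀ s t → s ∈ π → t ∈ π → ∀ j j' →
  label B (proj₁ s) ≡ just j → label B (proj₁ t) ≡ just j' →
  toℕ j ≡ ℓ → toℕ j' ≢ ℓ → proj₂ s ≢ proj₂ t

Produces : ∀ {n} (B : BP n) → List (Step B) → Fin n → Fin n → Set
Produces B π i z = Any (λ s → out B (proj₁ s) (proj₂ s) i ≡ just z) π

-- uniform probability over [n]^(2n-1) via counting

allFuns : ∀ m n → List (Fin m → Fin n)
allFuns zero n = (λ ()) ∷ []
allFuns (suc m) n = concatMap (λ f → map (λ a → cons a f) (allFin n)) (allFuns m n)
  where
  cons : Fin n → (Fin m → Fin n) → Fin (suc m) → Fin n
  cons a f zero = a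
  cons a f (suc i) = f i

allInputs : ∀ n → List (Input n)
allInputs n = allFuns (2 * n ∸ 1) n

count : ∀ {n} {P : Input n → Set} → Decidable P → ℕ
count {n} P? = length (filter P? (allInputs n))

Follows : ∀ {n} (B : BP n) → List (Step B) → Input n → Set
Follows B π x = πB B x ≡ π

follows? : ∀ {n} (B : BP n) (π : List (Step B)) → Decidable (Follows B π)
follows? B π x = List-≡-dec (×-≡-dec _≟_ _≟_) (πB B x) π

Correct : ∀ {n r} → (Fin r → Fin n) → (Fin r → Fin n) → Input n → Set
Correct i z x = ∀ a → suc (toℕ (z a)) ≡ F₀at x (i a)

EventE : ∀ {n} → Input n → Set
EventE {n} x = ∀ i → (n ≤ 2 * F₀at x i) × (20 * F₀at x i ≤ 17 * n)

Target : ∀ {n r} (B : BP n) → List (Step B) →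
         (Fin r → Fin n) → (Fin r → Fin n) → Input n → Set
Target B π i z x = Follows B π x × (Correct i z x × EventE x)

target? : ∀ {n r} (B : BP n) (π : List (Step B)) (i z : Fin r → Fin n) →
          Decidable (Target B π i z)
target? {n} B π i z x =
  follows? B π x ×-dec
  (all? (λ a → suc (toℕ (z a)) ℕ.≟ F₀at x (i a)) ×-dec
   all? (λ k → (n ≤? 2 * F₀at x k) ×-dec (20 * F₀at x k ≤? 17 * n)))

-- Probabilities are counts over all inputs.
--
-- Proof idea.  weight r x is the indicator that x follows π and every condition
-- "z_a is correct at window i_a, which has between 0.5n and 0.85n distinct symbols" holds;
-- it dominates the target event.  Dropping the first position k = i₁ costs a factor 17/18:
-- window k is the symbol at k followed by symbols beyond k, where all later windows lie.
--   * If π does not query k, sum over the n values at k (fibre decomposition).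
--   * If π queries k with answer v, π-uniqueness lets us exchange v with any symbol u that
--     answers no other query (all but at most q symbols) at every unqueried position; this
--     permutes the inputs, preserves following π and renames all later windows.
-- Either way the first window becomes "u followed by the rest of x", and a direct count
-- (symbol-bound) shows that at most 17/18 of the admissible u make it good.

module Submission where

open import Defs
open import Data.Nat using (ℕ; zero; suc; _+_; _*_; _∸_; _^_; _≤_; _<_; _>_; z≤n; s≤s; _≤?_; >-nonZero)
import Data.Nat as ℕ
open import Data.Nat.Properties hiding (_≟_)
open import Data.Nat.ListAction using (sum)
open import Data.Nat.ListAction.Properties using (sum-↭; sum-++)
open import Data.Nat.Tactic.RingSolver using (solve-∀)
open import Data.Fin using (Fin; toℕ)
import Data.Fin as F
open import Data.Fin.Properties using (_≟_; toℕ<n; toℕ-fromℕ<)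
open import Data.Fin.Permutation.Components using (transpose)
open import Data.List using (List; []; _∷_; map; filter; length; concatMap; allFin; deduplicate; _++_; take; drop; tabulate)
open import Data.List.Properties using (length-map; length-deduplicate; map-++; filter-all; length-filter; tabulate-cong; length-tabulate; map-tabulate; take-map)
open import Data.List.Membership.Propositional using (_∈_; _∉_; find; lose)
open import Data.List.Membership.Propositional.Properties using (∈-filter⁺; ∈-filter⁻; ∈-map⁺; ∈-map⁻; ∈-allFin; deduplicate-∈⇔)
open import Data.List.Membership.Propositional.Properties.WithK using (unique∧set⇒bag)
open import Data.List.Relation.Binary.BagAndSetEquality using (∼bag⇒↭)
open import Data.List.Relation.Binary.Permutation.Propositional using (_↭_)
open import Data.List.Relation.Binary.Permutation.Propositional.Properties using (↭-length)
import Data.List.Relation.Binary.Permutation.Propositional.Properties as ↭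
open import Data.List.Relation.Unary.Any using (Any; here; there; any?)
open import Data.List.Relation.Unary.All.Properties using (¬Any⇒All¬)
open import Data.List.Relation.Unary.Unique.Propositional using (Unique)
import Data.List.Relation.Unary.Unique.Propositional.Properties as Unique
open import Data.List.Relation.Unary.Unique.DecPropositional.Properties using (deduplicate-!)
open import Data.Maybe using (just; nothing)
open import Data.Maybe.Properties using (just-injective) renaming (≡-dec to Maybe-≡-dec)
open import Data.Empty using (⊥-elim)
open import Data.Product using (∃; _×_; _,_; proj₁; proj₂)
open import Function using (_∘_; id; _⇔_; mk⇔; Equivalence)
open import Algebra.Definitions using (Involutive)
open import Relation.Nullary using (Dec; yes; no; ¬_; ¬?)
open import Relation.Nullary.Decidable using (dec-true; dec-false; _×-dec_)
open import Relation.Binary.PropositionalEquality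

𝟙 : ∀ {p} {P : Set p} → Dec P → ℕ
𝟙 (yes _) = 1
𝟙 (no _) = 0

𝟙≤1 : ∀ {p} {P : Set p} (d : Dec P) → 𝟙 d ≤ 1
𝟙≤1 (yes _) = s≤s z≤n
𝟙≤1 (no _) = z≤n

𝟙-yes : ∀ {p} {P : Set p} (d : Dec P) → P → 𝟙 d ≡ 1
𝟙-yes (yes _) _ = refl
𝟙-yes (no ¬p) p = ⊥-elim (¬p p)

𝟙-no : ∀ {p} {P : Set p} (d : Dec P) → ¬ P → 𝟙 d ≡ 0
𝟙-no (yes p) ¬p = ⊥-elim (¬p p)
𝟙-no (no _) _ = refl

𝟙-cong : ∀ {p q} {P : Set p} {Q : Set q} (d : Dec P) (e : Dec Q) → (P → Q) → (Q → P) → 𝟙 d ≡ 𝟙 e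
𝟙-cong (yes _) (yes _) _ _ = refl
𝟙-cong (yes p) (no ¬q) f _ = ⊥-elim (¬q (f p))
𝟙-cong (no ¬p) (yes q) _ g = ⊥-elim (¬p (g q))
𝟙-cong (no _) (no _) _ _ = refl

𝟙-+-¬ : ∀ {p} {P : Set p} (d : Dec P) → 𝟙 d + 𝟙 (¬? d) ≡ 1
𝟙-+-¬ (yes _) = refl
𝟙-+-¬ (no _) = refl

𝟙-*-cong : ∀ {p} {P : Set p} (d : Dec P) {k k' : ℕ} → (P → k ≡ k') → 𝟙 d * k ≡ 𝟙 d * k'
𝟙-*-cong (yes p) eq = cong (1 *_) (eq p)
𝟙-*-cong (no _) _ = refl

∑ : ∀ {a} {A : Set a} → List A → (A → ℕ) → ℕ
∑ L f = sum (map f L)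

syntax ∑ L (λ x → e) = ∑[ x ∈ L ] e

module _ {a} {A : Set a} where

  ∑-cong : ∀ (L : List A) {f g : A → ℕ} → (∀ x → f x ≡ g x) → ∑ L f ≡ ∑ L g
  ∑-cong [] eq = refl
  ∑-cong (x ∷ L) eq = cong₂ _+_ (eq x) (∑-cong L eq)

  ∑-mono : ∀ (L : List A) {f g : A → ℕ} → (∀ x → f x ≤ g x) → ∑ L f ≤ ∑ L g
  ∑-mono [] le = z≤n
  ∑-mono (x ∷ L) le = +-mono-≤ (le x) (∑-mono L le)

  ∑-+ : ∀ (L : List A) (f g : A → ℕ) → ∑[ x ∈ L ] (f x + g x) ≡ ∑ L f + ∑ L g
  ∑-+ [] f g = refl
  ∑-+ (x ∷ L) f g rewrite ∑-+ L f g = +-shuffle (f x) (g x) (∑ L f) (∑ L g)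
    where
    +-shuffle : ∀ a b c d → a + b + (c + d) ≡ a + c + (b + d)
    +-shuffle = solve-∀

  ∑-*ˡ : ∀ (L : List A) (k : ℕ) (f : A → ℕ) → ∑[ x ∈ L ] (k * f x) ≡ k * ∑ L f
  ∑-*ˡ [] k f = sym (*-zeroʳ k)
  ∑-*ˡ (x ∷ L) k f rewrite ∑-*ˡ L k f = sym (*-distribˡ-+ k (f x) (∑ L f))

  ∑-*ʳ : ∀ (L : List A) (k : ℕ) (f : A → ℕ) → ∑[ x ∈ L ] (f x * k) ≡ ∑ L f * k
  ∑-*ʳ [] k f = refl
  ∑-*ʳ (x ∷ L) k f rewrite ∑-*ʳ L k f = sym (*-distribʳ-+ k (f x) (∑ L f))

  ∑-term : ∀ (L : List A) (f : A → ℕ) {x} → x ∈ L → f x ≤ ∑ L f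
  ∑-term (y ∷ L) f (here refl) = m≤m+n (f y) _
  ∑-term (y ∷ L) f (there x∈L) = ≤-trans (∑-term L f x∈L) (m≤n+m _ (f y))

  ∑-one : ∀ (L : List A) → ∑[ x ∈ L ] 1 ≡ length L
  ∑-one [] = refl
  ∑-one (x ∷ L) = cong suc (∑-one L)

  ∑-↭ : ∀ {L L' : List A} (f : A → ℕ) → L ↭ L' → ∑ L f ≡ ∑ L' f
  ∑-↭ f p = sum-↭ (↭.map⁺ f p)

  count-∑ : ∀ {p} {P : A → Set p} (P? : ∀ x → Dec (P x)) (L : List A) →
            length (filter P? L) ≡ ∑[ x ∈ L ] 𝟙 (P? x)
  count-∑ P? [] = refl
  count-∑ P? (x ∷ L) with P? x
  ... | yes _ = cong suc (count-∑ P? L)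
  ... | no _ = count-∑ P? L

  ∑-averaging : ∀ (L : List A) (w g : A → ℕ) (U : ℕ) → (∀ x → 18 * g x ≤ 17 * U) →
                18 * ∑[ x ∈ L ] (w x * g x) ≤ 17 * ∑[ x ∈ L ] (w x * U)
  ∑-averaging L w g U bound = begin
    18 * ∑[ x ∈ L ] (w x * g x)   ≡⟨ ∑-*ˡ L 18 _ ⟨
    ∑[ x ∈ L ] (18 * (w x * g x)) ≡⟨ ∑-cong L (λ x → e₁ (w x) (g x)) ⟩
    ∑[ x ∈ L ] (w x * (18 * g x)) ≤⟨ ∑-mono L (λ x → *-monoʳ-≤ (w x) (bound x)) ⟩
    ∑[ x ∈ L ] (w x * (17 * U))   ≡⟨ ∑-cong L (λ x → e₂ (w x) U) ⟩
    ∑[ x ∈ L ] (17 * (w x * U))   ≡⟨ ∑-*ˡ L 17 _ ⟩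
    17 * ∑[ x ∈ L ] (w x * U)     ∎
    where
    open ≤-Reasoning
    e₁ : ∀ w g → 18 * (w * g) ≡ w * (18 * g)
    e₁ = solve-∀
    e₂ : ∀ w U → w * (17 * U) ≡ 17 * (w * U)
    e₂ = solve-∀

module _ {a b} {A : Set a} {B : Set b} where

  ∑-swap : ∀ (L : List A) (M : List B) (f : A → B → ℕ) →
           ∑[ x ∈ L ] ∑[ y ∈ M ] f x y ≡ ∑[ y ∈ M ] ∑[ x ∈ L ] f x y
  ∑-swap [] M f = sym (∑-zero M)
    where
    ∑-zero : ∀ (M : List B) → ∑[ y ∈ M ] 0 ≡ 0
    ∑-zero [] = refl
    ∑-zero (_ ∷ M) = ∑-zero M
  ∑-swap (x ∷ L) M f rewrite ∑-swap L M f = sym (∑-+ M (f x) (λ y → ∑[ x ∈ L ] f x y))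

  ∑-map : ∀ (g : A → B) (L : List A) (f : B → ℕ) → ∑ (map g L) f ≡ ∑[ x ∈ L ] f (g x)
  ∑-map g [] f = refl
  ∑-map g (x ∷ L) f = cong (f (g x) +_) (∑-map g L f)

  ∑-concatMap : ∀ (g : A → List B) (L : List A) (f : B → ℕ) →
                ∑ (concatMap g L) f ≡ ∑[ x ∈ L ] ∑ (g x) f
  ∑-concatMap g [] f = refl
  ∑-concatMap g (x ∷ L) f = begin
    sum (map f (g x ++ concatMap g L))        ≡⟨ cong sum (map-++ f (g x) (concatMap g L)) ⟩
    sum (map f (g x) ++ map f (concatMap g L)) ≡⟨ sum-++ (map f (g x)) _ ⟩
    ∑ (g x) f + ∑ (concatMap g L) f           ≡⟨ cong (∑ (g x) f +_) (∑-concatMap g L f) ⟩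
    ∑ (g x) f + ∑[ y ∈ L ] ∑ (g y) f          ∎
    where open ≡-Reasoning

unique-↭ : ∀ {a} {A : Set a} {xs ys : List A} → Unique xs → Unique ys →
           (∀ {x} → x ∈ xs → x ∈ ys) → (∀ {x} → x ∈ ys → x ∈ xs) → xs ↭ ys
unique-↭ u u' to from = ∼bag⇒↭ (unique∧set⇒bag u u' (mk⇔ to from))

involution-injective : ∀ {a} {A : Set a} {σ : A → A} → Involutive _≡_ σ → ∀ {x y} → σ x ≡ σ y → x ≡ y
involution-injective {σ = σ} inv {x} {y} eq = trans (sym (inv x)) (trans (cong σ eq) (inv y))

-- The alphabet Fin n: reindexing sums, and counting distinct symbols.
module Symbols {n : ℕ} where
  open import Data.List.Membership.DecPropositional (_≟_ {n}) using (_∈?_)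

  ∑-involution : (σ : Fin n → Fin n) → Involutive _≡_ σ → (g : Fin n → ℕ) →
                 ∑[ u ∈ allFin n ] g (σ u) ≡ ∑ (allFin n) g
  ∑-involution σ inv g = trans (sym (∑-map σ (allFin n) g)) (∑-↭ g (unique-↭
    (Unique.map⁺ (involution-injective inv) (Unique.allFin⁺ n)) (Unique.allFin⁺ n)
    (λ _ → ∈-allFin _) (λ {u} _ → subst (_∈ map σ (allFin n)) (inv u) (∈-map⁺ σ (∈-allFin (σ u))))))

  occurs fresh : Fin n → List (Fin n) → ℕ
  occurs u L = 𝟙 (u ∈? L)
  fresh u L = 𝟙 (¬? (u ∈? L))

  private
    dedup : List (Fin n) → List (Fin n)
    dedup = deduplicate _≟_

    ∈-dedup⁺ : ∀ {u L} → u ∈ L → u ∈ dedup L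
    ∈-dedup⁺ = Equivalence.to (deduplicate-∈⇔ _≟_)

    ∈-dedup⁻ : ∀ {u L} → u ∈ dedup L → u ∈ L
    ∈-dedup⁻ = Equivalence.from (deduplicate-∈⇔ _≟_)

  F₀-∑ : ∀ L → F₀ L ≡ ∑[ u ∈ allFin n ] occurs u L
  F₀-∑ L = trans (↭-length (unique-↭ (deduplicate-! _≟_ L) (Unique.filter⁺ (_∈? L) {allFin n} (Unique.allFin⁺ n))
                    (λ u∈ → ∈-filter⁺ (_∈? L) (∈-allFin _) (∈-dedup⁻ u∈))
                    (λ u∈ → ∈-dedup⁺ (proj₂ (∈-filter⁻ (_∈? L) {xs = allFin n} u∈)))))
                 (count-∑ (_∈? L) (allFin n))

  ∑-point : ∀ t → ∑[ w ∈ allFin n ] 𝟙 (w ≟ t) ≡ 1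
  ∑-point t = trans (∑-cong (allFin n) λ w → 𝟙-cong (w ≟ t) (w ∈? t ∷ []) here λ { (here e) → e })
                    (sym (F₀-∑ (t ∷ [])))

  F₀≤length : ∀ L → F₀ L ≤ length L
  F₀≤length = length-deduplicate (_≟_ {n})

  F₀-∷ : ∀ u L → F₀ (u ∷ L) ≡ F₀ L + fresh u L
  F₀-∷ u L with u ∈? L
  ... | yes u∈L = trans (↭-length (unique-↭ (deduplicate-! _≟_ (u ∷ L)) (deduplicate-! _≟_ L)
                    (λ v∈ → ∈-dedup⁺ (∷⊆ (∈-dedup⁻ v∈))) (λ v∈ → ∈-dedup⁺ (there (∈-dedup⁻ v∈)))))
                    (sym (+-identityʳ _))
    where
    ∷⊆ : ∀ {v} → v ∈ u ∷ L → v ∈ L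
    ∷⊆ (here refl) = u∈L
    ∷⊆ (there v∈L) = v∈L
  ... | no u∉L = trans (cong (suc ∘ length) (filter-all (λ v → ¬? (u ≟ v)) (¬Any⇒All¬ _ (u∉L ∘ ∈-dedup⁻))))
                       (+-comm 1 (F₀ L))

  F₀-map : ∀ (σ : Fin n → Fin n) → Involutive _≡_ σ → ∀ L → F₀ (map σ L) ≡ F₀ L
  F₀-map σ inv L = trans (↭-length (unique-↭ (deduplicate-! _≟_ (map σ L))
                           (Unique.map⁺ (involution-injective inv) (deduplicate-! _≟_ L)) to from))
                         (length-map σ (dedup L))
    where
    to : ∀ {v} → v ∈ dedup (map σ L) → v ∈ map σ (dedup L)
    to v∈ with ∈-map⁻ σ (∈-dedup⁻ v∈)
    ... | w , w∈ , refl = ∈-map⁺ σ (∈-dedup⁺ w∈)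
    from : ∀ {v} → v ∈ map σ (dedup L) → v ∈ dedup (map σ L)
    from v∈ with ∈-map⁻ σ v∈
    ... | w , w∈ , refl = ∈-dedup⁺ (∈-map⁺ σ (∈-dedup⁻ w∈))

open Symbols

when : ∀ {p a} {P : Set p} {A : Set a} → Dec P → (A → A) → A → A
when (yes _) f = f
when (no _) _ = id

module _ {p a} {P : Set p} {A : Set a} {f : A → A} where

  when-yes : ∀ (d : Dec P) t → P → when d f t ≡ f t
  when-yes (yes _) t _ = refl
  when-yes (no ¬p) t p = ⊥-elim (¬p p)

  when-no : ∀ (d : Dec P) t → ¬ P → when d f t ≡ t
  when-no (yes p) t ¬p = ⊥-elim (¬p p)
  when-no (no _) t _ = refl

  when-involutive : ∀ (d : Dec P) → Involutive _≡_ f → Involutive _≡_ (when d f)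
  when-involutive (yes _) inv = inv
  when-involutive (no _) _ = λ _ → refl

module _ {n : ℕ} (a b : Fin n) where

  transpose-fixes : ∀ {t} → t ≢ a → t ≢ b → transpose a b t ≡ t
  transpose-fixes {t} t≢a t≢b rewrite dec-false (t ≟ a) t≢a | dec-false (t ≟ b) t≢b = refl

  transpose-first : transpose a b a ≡ b
  transpose-first rewrite dec-true (a ≟ a) refl = refl

  transpose-second : transpose a b b ≡ a
  transpose-second with b ≟ a
  ... | yes b≡a = b≡a
  ... | no _ rewrite dec-true (b ≟ b) refl = refl

  transpose-involutive : Involutive _≡_ (transpose a b)
  transpose-involutive t = by-cases (t ≟ a) (t ≟ b)
    where
    open ≡-Reasoning
    by-cases : Dec (t ≡ a) → Dec (t ≡ b) → transpose a b (transpose a b t) ≡ t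
    by-cases (yes t≡a) _ = begin
      transpose a b (transpose a b t) ≡⟨ cong (transpose a b ∘ transpose a b) t≡a ⟩
      transpose a b (transpose a b a) ≡⟨ cong (transpose a b) transpose-first ⟩
      transpose a b b                 ≡⟨ transpose-second ⟩
      a                               ≡⟨ t≡a ⟨
      t                               ∎
    by-cases (no _) (yes t≡b) = begin
      transpose a b (transpose a b t) ≡⟨ cong (transpose a b ∘ transpose a b) t≡b ⟩
      transpose a b (transpose a b b) ≡⟨ cong (transpose a b) transpose-second ⟩
      transpose a b a                 ≡⟨ transpose-first ⟩
      b                               ≡⟨ t≡b ⟨
      t                               ∎
    by-cases (no t≢a) (no t≢b) =
      trans (cong (transpose a b) (transpose-fixes t≢a t≢b)) (transpose-fixes t≢a t≢b)

Extensional : ∀ {m n} → ((Fin m → Fin n) → ℕ) → Set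
Extensional h = ∀ {x y} → x ≗ y → h x ≡ h y

_◃_ : ∀ {m n} → Fin n → (Fin m → Fin n) → Fin (suc m) → Fin n
(a ◃ f) F.zero = a
(a ◃ f) (F.suc j) = f j

∑-allFuns-suc : ∀ {m n} (h : (Fin (suc m) → Fin n) → ℕ) → Extensional h →
                ∑ (allFuns (suc m) n) h ≡ ∑[ f ∈ allFuns m n ] ∑[ a ∈ allFin n ] h (a ◃ f)
∑-allFuns-suc {m} {n} h ext = trans (∑-concatMap _ (allFuns m n) h)
  (∑-cong (allFuns m n) λ f → trans (∑-map _ (allFin n) h)
    (∑-cong (allFin n) λ a → ext λ { F.zero → refl ; (F.suc j) → refl }))

-- Applying an involution to each coordinate permutes the functions Fin m → Fin n,
-- so it leaves the sum of an extensional functional unchanged.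
∑-coordinatewise : ∀ {m n} (φ : Fin m → Fin n → Fin n) → (∀ j → Involutive _≡_ (φ j)) →
                   (h : (Fin m → Fin n) → ℕ) → Extensional h →
                   ∑[ x ∈ allFuns m n ] h (λ j → φ j (x j)) ≡ ∑ (allFuns m n) h
∑-coordinatewise {zero} φ inv h ext = cong (_+ 0) (ext (λ ()))
∑-coordinatewise {suc m} {n} φ inv h ext = begin
  ∑[ x ∈ allFuns (suc m) n ] h (φ̂ x)
    ≡⟨ ∑-allFuns-suc (h ∘ φ̂) (λ e → ext (λ j → cong (φ j) (e j))) ⟩
  ∑[ f ∈ allFuns m n ] ∑[ a ∈ allFin n ] h (φ̂ (a ◃ f))
    ≡⟨ ∑-cong (allFuns m n) (λ f → ∑-cong (allFin n) λ a → ext λ { F.zero → refl ; (F.suc j) → refl }) ⟩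
  ∑[ f ∈ allFuns m n ] ∑[ a ∈ allFin n ] h (φ F.zero a ◃ φ̂' f)
    ≡⟨ ∑-cong (allFuns m n) (λ f → ∑-involution (φ F.zero) (inv F.zero) (λ a → h (a ◃ φ̂' f))) ⟩
  ∑[ f ∈ allFuns m n ] ∑[ a ∈ allFin n ] h (a ◃ φ̂' f)
    ≡⟨ ∑-swap (allFuns m n) (allFin n) _ ⟩
  ∑[ a ∈ allFin n ] ∑[ f ∈ allFuns m n ] h (a ◃ φ̂' f)
    ≡⟨ ∑-cong (allFin n) (λ a → ∑-coordinatewise (φ ∘ F.suc) (inv ∘ F.suc) (h ∘ (a ◃_))
                                  (λ e → ext λ { F.zero → refl ; (F.suc j) → e j })) ⟩
  ∑[ a ∈ allFin n ] ∑[ f ∈ allFuns m n ] h (a ◃ f)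
    ≡⟨ ∑-swap (allFin n) (allFuns m n) _ ⟩
  ∑[ f ∈ allFuns m n ] ∑[ a ∈ allFin n ] h (a ◃ f)
    ≡⟨ ∑-allFuns-suc h ext ⟨
  ∑ (allFuns (suc m) n) h ∎
  where
  open ≡-Reasoning
  φ̂ : (Fin (suc m) → Fin n) → Fin (suc m) → Fin n
  φ̂ x j = φ j (x j)
  φ̂' : (Fin m → Fin n) → Fin m → Fin n
  φ̂' f j = φ (F.suc j) (f j)

_[_≔_] : ∀ {m n} → (Fin m → Fin n) → Fin m → Fin n → Fin m → Fin n
(x [ c ≔ w ]) j = when (j ≟ c) (λ _ → w) (x j)

-- Fibre decomposition along a coordinate c: each function is obtained exactly once
-- by changing the value at c of a function whose value at c is w₀.
∑-fibres : ∀ {m n} (c : Fin m) (w₀ : Fin n) (h : (Fin m → Fin n) → ℕ) → Extensional h →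
           ∑ (allFuns m n) h ≡ ∑[ x ∈ allFuns m n ] (𝟙 (w₀ ≟ x c) * ∑[ w ∈ allFin n ] h (x [ c ≔ w ]))
∑-fibres {m} {n} c w₀ h ext = begin
  ∑ X h                                               ≡⟨ ∑-cong X split ⟩
  ∑[ x ∈ X ] ∑[ w ∈ allFin n ] (𝟙 (w ≟ x c) * h x)      ≡⟨ ∑-swap X (allFin n) _ ⟩
  ∑[ w ∈ allFin n ] ∑[ x ∈ X ] (𝟙 (w ≟ x c) * h x)      ≡⟨ ∑-cong (allFin n) moved ⟨
  ∑[ w ∈ allFin n ] ∑[ x ∈ X ] (𝟙 (w ≟ τ w x c) * h (τ w x))
      ≡⟨ ∑-cong (allFin n) (λ w → ∑-cong X (λ x → fibre x w)) ⟩
  ∑[ w ∈ allFin n ] ∑[ x ∈ X ] (𝟙 (w₀ ≟ x c) * h (x [ c ≔ w ])) ≡⟨ ∑-swap (allFin n) X _ ⟩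
  ∑[ x ∈ X ] ∑[ w ∈ allFin n ] (𝟙 (w₀ ≟ x c) * h (x [ c ≔ w ]))
      ≡⟨ ∑-cong X (λ x → ∑-*ˡ (allFin n) (𝟙 (w₀ ≟ x c)) _) ⟩
  ∑[ x ∈ X ] (𝟙 (w₀ ≟ x c) * ∑[ w ∈ allFin n ] h (x [ c ≔ w ])) ∎
  where
  open ≡-Reasoning
  X = allFuns m n

  -- τ w exchanges the fibre of w₀ with the fibre of w over the coordinate c.
  τ : Fin n → (Fin m → Fin n) → Fin m → Fin n
  τ w x j = when (j ≟ c) (transpose w₀ w) (x j)

  split : ∀ x → h x ≡ ∑[ w ∈ allFin n ] (𝟙 (w ≟ x c) * h x)
  split x = sym (trans (∑-*ʳ (allFin n) (h x) _) (trans (cong (_* h x) (∑-point (x c))) (*-identityˡ (h x))))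

  moved : ∀ w → ∑[ x ∈ X ] (𝟙 (w ≟ τ w x c) * h (τ w x)) ≡ ∑[ x ∈ X ] (𝟙 (w ≟ x c) * h x)
  moved w = ∑-coordinatewise (λ j → when (j ≟ c) (transpose w₀ w))
    (λ j → when-involutive (j ≟ c) (transpose-involutive w₀ w))
    (λ x → 𝟙 (w ≟ x c) * h x) (λ e → cong₂ _*_ (cong (λ t → 𝟙 (w ≟ t)) (e c)) (ext e))

  fibre : ∀ x w → 𝟙 (w ≟ τ w x c) * h (τ w x) ≡ 𝟙 (w₀ ≟ x c) * h (x [ c ≔ w ])
  fibre x w = trans (cong (_* h (τ w x)) (𝟙-cong (w ≟ τ w x c) (w₀ ≟ x c) to from))
                    (𝟙-*-cong (w₀ ≟ x c) (λ w₀≡xc → ext (same w₀≡xc)))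
    where
    τc : τ w x c ≡ transpose w₀ w (x c)
    τc = when-yes (c ≟ c) (x c) refl
    to : w ≡ τ w x c → w₀ ≡ x c
    to e = sym (begin
      x c                                     ≡⟨ transpose-involutive w₀ w (x c) ⟨
      transpose w₀ w (transpose w₀ w (x c))  ≡⟨ cong (transpose w₀ w) (trans (sym τc) (sym e)) ⟩
      transpose w₀ w w                        ≡⟨ transpose-second w₀ w ⟩
      w₀                                      ∎)
    from : w₀ ≡ x c → w ≡ τ w x c
    from e = sym (trans τc (trans (cong (transpose w₀ w) (sym e)) (transpose-first w₀ w)))
    same : w₀ ≡ x c → τ w x ≗ x [ c ≔ w ]
    same e j with j ≟ c
    ... | yes refl = trans (cong (transpose w₀ w) (sym e)) (transpose-first w₀ w)
    ... | no _ = refl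

-- Queries and answers along paths of a branching program.
module Programs {n : ℕ} (B : BP n) where

  Queried : List (Step B) → Fin (2 * n ∸ 1) → Set
  Queried π j = Any (λ s → label B (proj₁ s) ≡ just j) π

  queried? : ∀ π j → Dec (Queried π j)
  queried? π j = any? (λ s → Maybe-≡-dec _≟_ (label B (proj₁ s)) (just j)) π

  run-answers : ∀ x f v {s j} → s ∈ run B x f v → label B (proj₁ s) ≡ just j → proj₂ s ≡ x j
  run-answers x zero v () _
  run-answers x (suc f) v s∈ ls with label B v in e
  run-answers x (suc f) v ()          ls | nothing
  run-answers x (suc f) v (here refl) ls | just j = cong x (just-injective (trans (sym e) ls))
  run-answers x (suc f) v (there s∈)  ls | just j = run-answers x f (next B v (x j)) s∈ ls

  run-agree : ∀ x y f v → (∀ j → Queried (run B x f v) j → y j ≡ x j) → run B y f v ≡ run B x f v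
  run-agree x y zero v _ = refl
  run-agree x y (suc f) v agree with label B v in e
  ... | nothing = refl
  ... | just j rewrite agree j (here e) =
    cong ((v , x j) ∷_) (run-agree x y f (next B v (x j)) (λ j' q → agree j' (there q)))

  πB-extensional : ∀ {x y} → x ≗ y → πB B x ≡ πB B y
  πB-extensional {x} {y} x≗y = sym (run-agree x y (N B) (source B) (λ j _ → sym (x≗y j)))

  module _ {π : List (Step B)} {x : Input n} (fx : Follows B π x) where

    follows-answers : ∀ {s j} → s ∈ π → label B (proj₁ s) ≡ just j → proj₂ s ≡ x j
    follows-answers s∈ ls = run-answers x (N B) (source B) (subst (_ ∈_) (sym fx) s∈) ls

    follows-agree : ∀ y → (∀ j → Queried π j → y j ≡ x j) → Follows B π y
    follows-agree y agree =
      trans (run-agree x y (N B) (source B) (subst (λ π' → ∀ j → Queried π' j → y j ≡ x j) (sym fx) agree)) fx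

module _ {a} {A : Set a} where

  drop-tabulate-local : ∀ {M} d (g h : Fin M → A) (σ : A → A) → (∀ j → d ≤ toℕ j → h j ≡ σ (g j)) →
                        drop d (tabulate h) ≡ map σ (drop d (tabulate g))
  drop-tabulate-local {zero} zero g h σ _ = refl
  drop-tabulate-local {zero} (suc d) g h σ _ = refl
  drop-tabulate-local {suc M} zero g h σ eq =
    trans (tabulate-cong (λ j → eq j z≤n)) (sym (map-tabulate g σ))
  drop-tabulate-local {suc M} (suc d) g h σ eq =
    drop-tabulate-local d (g ∘ F.suc) (h ∘ F.suc) σ (λ j d≤j → eq (F.suc j) (s≤s d≤j))

  drop-tabulate-∷ : ∀ {M} d (d<M : d < M) (g : Fin M → A) →
                    drop d (tabulate g) ≡ g (F.fromℕ< d<M) ∷ drop (suc d) (tabulate g)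
  drop-tabulate-∷ {suc M} zero _ g = refl
  drop-tabulate-∷ {suc M} (suc d) (s≤s d<M) g = drop-tabulate-∷ d d<M (g ∘ F.suc)

module Windows {n' : ℕ} where

  private
    n = suc n'

    n≤2n∸1 : n ≤ 2 * n ∸ 1
    n≤2n∸1 rewrite +-identityʳ n' | +-suc n' n' = s≤s (m≤m+n n' n')

  start : Fin n → Fin (2 * n ∸ 1)
  start k = F.fromℕ< (≤-trans (toℕ<n k) n≤2n∸1)

  toℕ-start : ∀ k → toℕ (start k) ≡ toℕ k
  toℕ-start k = toℕ-fromℕ< _

  rest : Input n → Fin n → List (Fin n)
  rest x k = take n' (drop (suc (toℕ k)) (tabulate x))

  window-∷ : ∀ x k → window x k ≡ x (start k) ∷ rest x k
  window-∷ x k = cong (take n) (drop-tabulate-∷ (toℕ k) (≤-trans (toℕ<n k) n≤2n∸1) x)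

  window-extensional : ∀ {x y : Input n} → x ≗ y → ∀ k → window x k ≡ window y k
  window-extensional x≗y k = cong (take n ∘ drop (toℕ k)) (tabulate-cong x≗y)

  window-local : ∀ {x y : Input n} k (σ : Fin n → Fin n) → (∀ j → toℕ k ≤ toℕ j → y j ≡ σ (x j)) →
                 window y k ≡ map σ (window x k)
  window-local {x} {y} k σ eq =
    trans (cong (take n) (drop-tabulate-local (toℕ k) x y σ eq)) (take-map n _)

  rest-local : ∀ {x y : Input n} k (σ : Fin n → Fin n) → (∀ j → toℕ k < toℕ j → y j ≡ σ (x j)) →
               rest y k ≡ map σ (rest x k)
  rest-local {x} {y} k σ eq =
    trans (cong (take n') (drop-tabulate-local (suc (toℕ k)) x y σ eq)) (take-map n' _)

-- Two linear estimates behind the 17/18 bound.  U counts admissible symbols,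
-- of which a occur and b do not occur in the rest of a window with f distinct symbols.
module Estimates where
  open ≤-Reasoning

  -- Few admissible symbols occur when the window has at most 0.85 n distinct ones.
  occurring-bound : ∀ {a f n U q} → a ≤ f → 20 * f ≤ 17 * n → n ≤ U + q → 10 * q ≤ n →
                    18 * a ≤ 17 * U
  occurring-bound {a} {f} {n} {U} {q} a≤f f≤ n≤ q≤ = *-cancelˡ-≤ 20 (begin
    20 * (18 * a)  ≤⟨ *-monoʳ-≤ 20 (*-monoʳ-≤ 18 a≤f) ⟩
    20 * (18 * f)  ≡⟨ e₁ f ⟩
    18 * (20 * f)  ≤⟨ *-monoʳ-≤ 18 f≤ ⟩
    18 * (17 * n)  ≡⟨ e₂ n ⟩
    306 * n        ≤⟨ +-cancelʳ-≤ (340 * q) (306 * n) (340 * U) (begin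
      306 * n + 340 * q         ≡⟨ e₃ n q ⟩
      306 * n + 34 * (10 * q)   ≤⟨ +-monoʳ-≤ (306 * n) (*-monoʳ-≤ 34 q≤) ⟩
      306 * n + 34 * n          ≡⟨ e₄ n ⟩
      340 * n                   ≤⟨ *-monoʳ-≤ 340 n≤ ⟩
      340 * (U + q)             ≡⟨ *-distribˡ-+ 340 U q ⟩
      340 * U + 340 * q         ∎) ⟩
    340 * U        ≡⟨ e₅ U ⟩
    20 * (17 * U)  ∎)
    where
    e₁ : ∀ f → 20 * (18 * f) ≡ 18 * (20 * f)
    e₁ = solve-∀
    e₂ : ∀ n → 18 * (17 * n) ≡ 306 * n
    e₂ = solve-∀
    e₃ : ∀ n q → 306 * n + 340 * q ≡ 306 * n + 34 * (10 * q)
    e₃ = solve-∀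
    e₄ : ∀ n → 306 * n + 34 * n ≡ 340 * n
    e₄ = solve-∀
    e₅ : ∀ U → 340 * U ≡ 20 * (17 * U)
    e₅ = solve-∀

  -- Few admissible symbols are fresh when the window has at least 0.5 n distinct ones.
  fresh-bound : ∀ {a b f n q} → a + b ≤ n → n ≤ 2 * suc f → f ≤ a + q → 10 * q ≤ n → 10 ≤ n →
                18 * b ≤ 17 * (a + b)
  fresh-bound {a} {b} {f} {n} {q} ab≤n n≤ f≤ q≤ 10≤n = begin
    18 * b          ≡⟨ e₁ b ⟩
    17 * b + b      ≤⟨ +-monoʳ-≤ (17 * b) b≤17a ⟩
    17 * b + 17 * a ≡⟨ e₂ a b ⟩
    17 * (a + b)    ∎
    where
    e₁ : ∀ b → 18 * b ≡ 17 * b + b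
    e₁ = solve-∀
    e₂ : ∀ a b → 17 * b + 17 * a ≡ 17 * (a + b)
    e₂ = solve-∀
    e₃ : ∀ n → 6 * n + 4 * n ≡ 10 * n
    e₃ = solve-∀
    e₄ : ∀ a q → 20 * (a + q) + 20 ≡ 20 * a + (2 * (10 * q) + 2 * 10)
    e₄ = solve-∀
    e₅ : ∀ a n → 20 * a + (2 * n + 2 * n) ≡ 20 * a + 4 * n
    e₅ = solve-∀
    e₆ : ∀ a → 102 * a ≡ 6 * (17 * a)
    e₆ = solve-∀
    e₇ : ∀ f → 10 * (2 * suc f) ≡ 20 * f + 20
    e₇ = solve-∀
    6n≤20a : 6 * n ≤ 20 * a
    6n≤20a = +-cancelʳ-≤ (4 * n) (6 * n) (20 * a) (begin
      6 * n + 4 * n                ≡⟨ e₃ n ⟩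
      10 * n                       ≤⟨ *-monoʳ-≤ 10 n≤ ⟩
      10 * (2 * suc f)             ≡⟨ e₇ f ⟩
      20 * f + 20                  ≤⟨ +-monoˡ-≤ 20 (*-monoʳ-≤ 20 f≤) ⟩
      20 * (a + q) + 20            ≡⟨ e₄ a q ⟩
      20 * a + (2 * (10 * q) + 2 * 10)
        ≤⟨ +-monoʳ-≤ (20 * a) (+-mono-≤ (*-monoʳ-≤ 2 q≤) (*-monoʳ-≤ 2 10≤n)) ⟩
      20 * a + (2 * n + 2 * n)     ≡⟨ e₅ a n ⟩
      20 * a + 4 * n               ∎)
    b≤17a : b ≤ 17 * a
    b≤17a = *-cancelˡ-≤ 6 (begin
      6 * b         ≤⟨ *-monoʳ-≤ 6 (≤-trans (m≤n+m b a) ab≤n) ⟩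
      6 * n         ≤⟨ 6n≤20a ⟩
      20 * a        ≤⟨ *-monoˡ-≤ a (m≤m+n 20 82) ⟩
      102 * a       ≡⟨ e₆ a ⟩
      6 * (17 * a)  ∎)

open Estimates

-- Good windows and the counting estimate, for a fixed alphabet size n.
module GoodWindows {n : ℕ} where
  open import Data.List.Membership.DecPropositional (_≟_ {n}) using (_∈?_)

  Good : Fin n → ℕ → Set
  Good z g = suc (toℕ z) ≡ g × (n ≤ 2 * g × 20 * g ≤ 17 * n)

  good? : ∀ z g → Dec (Good z g)
  good? z g = (suc (toℕ z) ℕ.≟ g) ×-dec ((n ≤? 2 * g) ×-dec (20 * g ≤? 17 * n))

  good : Fin n → ℕ → ℕ
  good z g = 𝟙 (good? z g)

  -- Symbols outside a list Bl are admissible; we count them by whether they occur in R.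
  module Admissible (R Bl : List (Fin n)) where

    admissible blocked : Fin n → ℕ
    admissible u = fresh u Bl
    blocked u = occurs u Bl

    #occurring #fresh #admissible : ℕ
    #occurring = ∑[ u ∈ allFin n ] (admissible u * occurs u R)
    #fresh = ∑[ u ∈ allFin n ] (admissible u * fresh u R)
    #admissible = ∑ (allFin n) admissible

    private
      share : ∀ k o fr → o + fr ≡ 1 → k ≡ o * k + fr * k
      share k o fr eq = trans (sym (*-identityˡ k)) (trans (cong (_* k) (sym eq)) (*-distribʳ-+ k o fr))

    #admissible-split : #admissible ≡ #occurring + #fresh
    #admissible-split = trans
      (∑-cong (allFin n) λ u → trans (share (admissible u) (occurs u R) (fresh u R) (𝟙-+-¬ (u ∈? R)))
        (cong₂ _+_ (*-comm (occurs u R) (admissible u)) (*-comm (fresh u R) (admissible u))))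
      (∑-+ (allFin n) _ _)

    #admissible+#blocked : #admissible + ∑ (allFin n) blocked ≡ n
    #admissible+#blocked = trans (sym (∑-+ (allFin n) admissible blocked))
      (trans (∑-cong (allFin n) λ u → trans (+-comm (admissible u) (blocked u)) (𝟙-+-¬ (u ∈? Bl)))
             (trans (∑-one (allFin n)) (length-tabulate id)))

    #blocked≤length : ∑ (allFin n) blocked ≤ length Bl
    #blocked≤length = ≤-trans (≤-reflexive (sym (F₀-∑ Bl))) (F₀≤length Bl)

    #occurring≤F₀ : #occurring ≤ F₀ R
    #occurring≤F₀ = ≤-trans
      (∑-mono (allFin n) λ u → ≤-trans (*-monoˡ-≤ (occurs u R) (𝟙≤1 (¬? (u ∈? Bl)))) (≤-reflexive (+-identityʳ _)))
      (≤-reflexive (sym (F₀-∑ R)))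

    -- Every symbol of R is either admissible or blocked.
    F₀≤#occurring+#blocked : F₀ R ≤ #occurring + ∑ (allFin n) blocked
    F₀≤#occurring+#blocked = begin
      F₀ R                                  ≡⟨ F₀-∑ R ⟩
      ∑[ u ∈ allFin n ] occurs u R           ≡⟨ ∑-cong (allFin n) both ⟩
      ∑[ u ∈ allFin n ] (admissible u * occurs u R + blocked u * occurs u R)
                                            ≡⟨ ∑-+ (allFin n) (λ u → admissible u * occurs u R) _ ⟩
      #occurring + ∑[ u ∈ allFin n ] (blocked u * occurs u R)
                                            ≤⟨ +-monoʳ-≤ #occurring (∑-mono (allFin n) at-most-blocked) ⟩
      #occurring + ∑ (allFin n) blocked     ∎
      where
      open ≤-Reasoning
      both : ∀ u → occurs u R ≡ admissible u * occurs u R + blocked u * occurs u R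
      both u = trans (share (occurs u R) (blocked u) (admissible u) (𝟙-+-¬ (u ∈? Bl)))
                     (+-comm (blocked u * occurs u R) (admissible u * occurs u R))
      at-most-blocked : ∀ u → blocked u * occurs u R ≤ blocked u
      at-most-blocked u = ≤-trans (*-monoʳ-≤ (blocked u) (𝟙≤1 (u ∈? R))) (≤-reflexive (*-identityʳ _))

    -- Placing an admissible u in front of R gives F₀ R distinct symbols if u occurs in R,
    -- and one more otherwise.
    ∑-placed : ∀ (g : ℕ → ℕ) → ∑[ u ∈ allFin n ] (admissible u * g (F₀ R + fresh u R))
                              ≡ g (F₀ R) * #occurring + g (suc (F₀ R)) * #fresh
    ∑-placed g = trans (∑-cong (allFin n) λ u → placed (admissible u) (occurs u R) (fresh u R) (𝟙-+-¬ (u ∈? R)))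
      (trans (∑-+ (allFin n) (λ u → g f * (admissible u * occurs u R)) (λ u → g (suc f) * (admissible u * fresh u R)))
             (cong₂ _+_ (∑-*ˡ (allFin n) (g f) (λ u → admissible u * occurs u R))
                        (∑-*ˡ (allFin n) (g (suc f)) (λ u → admissible u * fresh u R))))
      where
      f = F₀ R
      placed : ∀ k o fr → o + fr ≡ 1 → k * g (f + fr) ≡ g f * (k * o) + g (suc f) * (k * fr)
      placed k 1 0 refl = trans (cong (λ h → k * g h) (+-identityʳ f)) (e k (g f) (g (suc f)))
        where
        e : ∀ k h h' → k * h ≡ h * (k * 1) + h' * (k * 0)
        e = solve-∀
      placed k 0 1 refl = trans (cong (λ h → k * g h) (+-comm f 1)) (e k (g f) (g (suc f)))
        where
        e : ∀ k h h' → k * h' ≡ h * (k * 0) + h' * (k * 1)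
        e = solve-∀

  symbol-bound : ∀ q (z : Fin n) (R Bl : List (Fin n)) → length Bl ≤ q → 10 * q ≤ n → 10 ≤ n →
                 18 * ∑[ u ∈ allFin n ] (fresh u Bl * good z (F₀ R + fresh u R))
                   ≤ 17 * ∑[ u ∈ allFin n ] fresh u Bl
  symbol-bound q z R Bl Bl≤q q≤ 10≤n = begin
    18 * ∑[ u ∈ allFin n ] (admissible u * good z (f + fresh u R)) ≡⟨ cong (18 *_) (∑-placed (good z)) ⟩
    18 * (good z f * #occurring + good z (suc f) * #fresh)        ≤⟨ by-cases (good? z f) (good? z (suc f)) ⟩
    17 * #admissible                                              ∎
    where
    open ≤-Reasoning
    open Admissible R Bl
    f = F₀ R
    #blocked≤q : ∑ (allFin n) blocked ≤ q
    #blocked≤q = ≤-trans #blocked≤length Bl≤q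
    -- The two conditions are exclusive: z fixes the number of distinct symbols.
    by-cases : (d : Dec (Good z f)) (d' : Dec (Good z (suc f))) →
               18 * (𝟙 d * #occurring + 𝟙 d' * #fresh) ≤ 17 * #admissible
    by-cases (yes (z≡f , _)) (yes (z≡sf , _)) = ⊥-elim (1+n≢n (sym (trans (sym z≡f) z≡sf)))
    by-cases (yes (_ , _ , f≤)) (no _) rewrite *-identityˡ #occurring | +-identityʳ #occurring =
      occurring-bound {q = q} #occurring≤F₀ f≤
        (subst (_≤ #admissible + q) #admissible+#blocked (+-monoʳ-≤ #admissible #blocked≤q)) q≤
    by-cases (no _) (yes (_ , n≤ , _)) rewrite *-identityˡ #fresh | #admissible-split =
      fresh-bound {#occurring} {#fresh}
        (subst (_≤ n) #admissible-split (subst (#admissible ≤_) #admissible+#blocked (m≤m+n #admissible _)))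
        n≤ (≤-trans F₀≤#occurring+#blocked (+-monoʳ-≤ #occurring #blocked≤q)) q≤ 10≤n
    by-cases (no _) (no _) = z≤n

module Correctness {n' : ℕ} (B : BP (suc n')) (π : List (Step B)) where
  open Programs B
  open Windows {n'}
  open GoodWindows {suc n'}
  open import Data.List.Membership.DecPropositional (_≟_ {suc n'}) using (_∈?_)

  private
    n = suc n'
    Inputs = allInputs n

  weight : ∀ r → (Fin r → Fin n) → (Fin r → Fin n) → Input n → ℕ
  weight zero i z x = 𝟙 (follows? B π x)
  weight (suc r) i z x = good (z F.zero) (F₀at x (i F.zero)) * weight r (i ∘ F.suc) (z ∘ F.suc) x

  weight-extensional : ∀ r i z → Extensional (weight r i z)
  weight-extensional zero i z x≗y =
    𝟙-cong (follows? B π _) (follows? B π _) (trans (sym (πB-extensional x≗y))) (trans (πB-extensional x≗y))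
  weight-extensional (suc r) i z x≗y =
    cong₂ _*_ (cong (good (z F.zero) ∘ F₀) (window-extensional x≗y (i F.zero))) (weight-extensional r _ _ x≗y)

  weight-off-path : ∀ r i z {x} → ¬ Follows B π x → weight r i z x ≡ 0
  weight-off-path zero i z {x} ¬fx = 𝟙-no (follows? B π x) ¬fx
  weight-off-path (suc r) i z {x} ¬fx =
    trans (cong (g *_) (weight-off-path r (i ∘ F.suc) (z ∘ F.suc) ¬fx)) (*-zeroʳ g)
    where g = good (z F.zero) (F₀at x (i F.zero))

  weight-target : ∀ r i z {x} → Target B π i z x → weight r i z x ≡ 1
  weight-target zero i z {x} (fx , _) = 𝟙-yes (follows? B π x) fx
  weight-target (suc r) i z {x} (fx , correct , inE) = cong₂ _*_
    (𝟙-yes (good? (z F.zero) (F₀at x (i F.zero))) (correct F.zero , inE (i F.zero)))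
    (weight-target r (i ∘ F.suc) (z ∘ F.suc) (fx , correct ∘ F.suc , inE))

  count-target≤ : ∀ r i z → count (target? B π i z) ≤ ∑ Inputs (weight r i z)
  count-target≤ r i z = ≤-trans (≤-reflexive (count-∑ (target? B π i z) Inputs))
                                (∑-mono Inputs λ x → bound (target? B π i z x))
    where
    bound : ∀ {x} (d : Dec (Target B π i z x)) → 𝟙 d ≤ weight r i z x
    bound (yes t) = ≤-reflexive (sym (weight-target r i z t))
    bound (no _) = z≤n

  weight-rename : ∀ ℓ r i z {x y} (σ : Fin n → Fin n) → Involutive _≡_ σ → (∀ a → ℓ < toℕ (i a)) →
                  Follows B π y ⇔ Follows B π x → (∀ j → ℓ < toℕ j → y j ≡ σ (x j)) →
                  weight r i z y ≡ weight r i z x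
  weight-rename ℓ zero i z σ _ _ fy⇔fx _ =
    𝟙-cong (follows? B π _) (follows? B π _) (Equivalence.to fy⇔fx) (Equivalence.from fy⇔fx)
  weight-rename ℓ (suc r) i z {x} {y} σ inv later fy⇔fx y≡σx =
    cong₂ _*_ (cong (good (z F.zero)) F₀-same)
              (weight-rename ℓ r (i ∘ F.suc) (z ∘ F.suc) σ inv (later ∘ F.suc) fy⇔fx y≡σx)
    where
    F₀-same : F₀at y (i F.zero) ≡ F₀at x (i F.zero)
    F₀-same = trans (cong F₀ (window-local (i F.zero) σ λ j k≤j → y≡σx j (<-≤-trans (later F.zero) k≤j)))
                    (F₀-map σ inv (window x (i F.zero)))

  -- One step of the induction on r: the condition at the first position k = i 0, which
  -- is π-unique, holds for at most a 17/18 fraction of the inputs satisfying the others.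
  module Step (q : ℕ) (π≤q : length π ≤ q) (q≤ : 10 * q ≤ n) (10≤n : 10 ≤ n)
              {r : ℕ} (i z : Fin (suc r) → Fin n)
              (later : ∀ a → toℕ (i F.zero) < toℕ (i (F.suc a)))
              (unique : PiUnique B π (toℕ (i F.zero))) where

    k = i F.zero
    ℓ = toℕ k
    c = start k
    z₀ = z F.zero

    G S : Input n → ℕ
    G = weight (suc r) i z
    S = weight r (i ∘ F.suc) (z ∘ F.suc)

    beyond-c : ∀ j → ℓ < toℕ j → j ≢ c
    beyond-c j ℓ<j j≡c = <-irrefl (sym (trans (cong toℕ j≡c) (toℕ-start k))) ℓ<j

    -- P x u: the first condition would hold if window k were u followed by the rest of x.
    P : Input n → Fin n → ℕ
    P x u = good z₀ (F₀ (rest x k) + fresh u (rest x k))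

    weight-place : ∀ {x y} u (σ : Fin n → Fin n) → Involutive _≡_ σ →
                   Follows B π y ⇔ Follows B π x → y c ≡ σ u → (∀ j → ℓ < toℕ j → y j ≡ σ (x j)) →
                   G y ≡ P x u * S x
    weight-place {x} {y} u σ inv fy⇔fx yc≡σu y≡σx =
      cong₂ _*_ (cong (good z₀) F₀-window) (weight-rename ℓ r (i ∘ F.suc) (z ∘ F.suc) σ inv later fy⇔fx y≡σx)
      where
      open ≡-Reasoning
      F₀-window : F₀ (window y k) ≡ F₀ (rest x k) + fresh u (rest x k)
      F₀-window = begin
        F₀ (window y k)              ≡⟨ cong F₀ (window-∷ y k) ⟩
        F₀ (y c ∷ rest y k)          ≡⟨ cong F₀ (cong₂ _∷_ yc≡σu (rest-local k σ y≡σx)) ⟩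
        F₀ (map σ (u ∷ rest x k))    ≡⟨ F₀-map σ inv (u ∷ rest x k) ⟩
        F₀ (u ∷ rest x k)            ≡⟨ F₀-∷ u (rest x k) ⟩
        F₀ (rest x k) + fresh u (rest x k) ∎

    -- Case 1: π does not query position c.  Summing over the value at c, each input
    -- satisfying the other conditions contributes its proportion of good values.
    module Unqueried (¬qc : ¬ Queried π c) where

      follows-update : ∀ (x : Input n) (w : Fin n) → Follows B π (x [ c ≔ w ]) ⇔ Follows B π x
      follows-update x w = mk⇔ (λ fy → follows-agree fy x (λ j qj → sym (unchanged j qj)))
                               (λ fx → follows-agree fx (x [ c ≔ w ]) unchanged)
        where
        unchanged : ∀ j → Queried π j → (x [ c ≔ w ]) j ≡ x j
        unchanged j qj = when-no (j ≟ c) (x j) (λ { refl → ¬qc qj })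

      beyond-update : ∀ (x : Input n) (w : Fin n) j → ℓ < toℕ j → (x [ c ≔ w ]) j ≡ x j
      beyond-update x w j ℓ<j = when-no (j ≟ c) (x j) (beyond-c j ℓ<j)

      G-update : ∀ (x : Input n) (w : Fin n) → G (x [ c ≔ w ]) ≡ S x * (fresh w [] * P x w)
      G-update x w = trans (weight-place w id (λ _ → refl) (follows-update x w) (when-yes (c ≟ c) (x c) refl)
                                         (beyond-update x w))
                           (trans (*-comm (P x w) (S x)) (cong (S x *_) (sym (*-identityˡ (P x w)))))

      S-update : ∀ (x : Input n) (w : Fin n) → S (x [ c ≔ w ]) ≡ S x * fresh w []
      S-update x w = trans (weight-rename ℓ r (i ∘ F.suc) (z ∘ F.suc) id (λ _ → refl) later
                                          (follows-update x w) (beyond-update x w))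
                           (sym (*-identityʳ (S x)))

      -- The proportion of good values at c for x, and the resulting fibre sums; the fibres
      -- are taken over a reference symbol at c, for which any symbol (here z₀) will do.
      A : Input n → ℕ
      A x = ∑[ w ∈ allFin n ] (fresh w [] * P x w)

      I : Input n → ℕ
      I x = 𝟙 (z₀ ≟ x c)

      ∑G-fibre : ∀ x → ∑[ w ∈ allFin n ] G (x [ c ≔ w ]) ≡ S x * A x
      ∑G-fibre x = trans (∑-cong (allFin n) (G-update x)) (∑-*ˡ (allFin n) (S x) _)

      ∑S-fibre : ∀ x → ∑[ w ∈ allFin n ] S (x [ c ≔ w ]) ≡ S x * n
      ∑S-fibre x = trans (∑-cong (allFin n) (S-update x))
                         (trans (∑-*ˡ (allFin n) (S x) _) (cong (S x *_) ∑-all))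
        where
        ∑-all : ∑[ w ∈ allFin n ] fresh w [] ≡ n
        ∑-all = trans (∑-one (allFin n)) (length-tabulate id)

      A-bound : ∀ x → 18 * A x ≤ 17 * n
      A-bound x = subst (λ U → 18 * A x ≤ 17 * U) (trans (∑-one (allFin n)) (length-tabulate id))
                        (symbol-bound q z₀ (rest x k) [] z≤n q≤ 10≤n)

      result : 18 * ∑ Inputs G ≤ 17 * ∑ Inputs S
      result = begin
        18 * ∑ Inputs G
          ≡⟨ cong (18 *_) (trans (∑-fibres c z₀ G (weight-extensional (suc r) i z))
                                 (∑-cong Inputs λ x → cong (I x *_) (∑G-fibre x))) ⟩
        18 * ∑[ x ∈ Inputs ] (I x * (S x * A x))
          ≡⟨ cong (18 *_) (∑-cong Inputs λ x → sym (*-assoc (I x) (S x) (A x))) ⟩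
        18 * ∑[ x ∈ Inputs ] (I x * S x * A x)
          ≤⟨ ∑-averaging Inputs (λ x → I x * S x) A n A-bound ⟩
        17 * ∑[ x ∈ Inputs ] (I x * S x * n)
          ≡⟨ cong (17 *_) (∑-cong Inputs λ x → *-assoc (I x) (S x) n) ⟩
        17 * ∑[ x ∈ Inputs ] (I x * (S x * n))
          ≡⟨ cong (17 *_) (trans (∑-fibres c z₀ S (weight-extensional r (i ∘ F.suc) (z ∘ F.suc)))
                                 (∑-cong Inputs λ x → cong (I x *_) (∑S-fibre x))) ⟨
        17 * ∑ Inputs S ∎
        where open ≤-Reasoning

    -- Case 2: π queries position c at a step s, with answer v.  By π-uniqueness v answers
    -- no other query; exchanging v with a symbol u that answers no other query, at all
    -- unqueried positions, preserves following π and acts on the windows as a renaming.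
    module Queried {s : Step B} (s∈π : s ∈ π) (ls : label B (proj₁ s) ≡ just c) where

      v = proj₂ s

      OtherQuery : Step B → Set
      OtherQuery t = ∃ λ j → label B (proj₁ t) ≡ just j × toℕ j ≢ ℓ

      otherQuery? : ∀ t → Dec (OtherQuery t)
      otherQuery? t = decide (label B (proj₁ t)) refl
        where
        decide : ∀ mj → label B (proj₁ t) ≡ mj → Dec (OtherQuery t)
        decide nothing lt = no λ { (j , lt' , _) → nothing≢just (trans (sym lt) lt') }
          where
          nothing≢just : ∀ {j} → nothing ≢ just j
          nothing≢just ()
        decide (just j) lt with toℕ j ℕ.≟ ℓ
        ... | yes j≡ℓ = no λ { (j' , lt' , j'≢ℓ) → j'≢ℓ (trans (cong toℕ (just-injective (trans (sym lt') lt))) j≡ℓ) }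
        ... | no j≢ℓ = yes (j , lt , j≢ℓ)

      otherAnswers : List (Fin n)
      otherAnswers = map proj₂ (filter otherQuery? π)

      otherAnswers≤q : length otherAnswers ≤ q
      otherAnswers≤q = ≤-trans (≤-reflexive (length-map proj₂ (filter otherQuery? π)))
                               (≤-trans (length-filter otherQuery? π) π≤q)

      answer-other : ∀ {t j} → t ∈ π → label B (proj₁ t) ≡ just j → toℕ j ≢ ℓ → proj₂ t ∈ otherAnswers
      answer-other t∈π lt j≢ℓ = ∈-map⁺ proj₂ (∈-filter⁺ otherQuery? t∈π (_ , lt , j≢ℓ))

      v-admissible : v ∉ otherAnswers
      v-admissible v∈ with ∈-map⁻ proj₂ v∈
      ... | t , t∈ , v≡ with ∈-filter⁻ otherQuery? t∈
      ...   | t∈π , (j , lt , j≢ℓ) = unique s t s∈π t∈π c j ls lt (toℕ-start k) j≢ℓ v≡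

      τ : Fin n → Input n → Input n
      τ u x j = when (¬? (queried? π j)) (transpose v u) (x j)

      τ-queried : ∀ u x j → Queried π j → τ u x j ≡ x j
      τ-queried u x j qj = when-no (¬? (queried? π j)) (x j) (λ ¬qj → ¬qj qj)

      follows-τ : ∀ u x → Follows B π (τ u x) ⇔ Follows B π x
      follows-τ u x = mk⇔ (λ fy → follows-agree fy x (λ j qj → sym (τ-queried u x j qj)))
                          (λ fx → follows-agree fx (τ u x) (τ-queried u x))

      module _ {u : Fin n} (u∉ : u ∉ otherAnswers) {x : Input n} (fx : Follows B π x) where

        -- Beyond ℓ, a queried position holds neither v nor u, so τ u acts there as the exchange.
        τ-beyond : ∀ j → ℓ < toℕ j → τ u x j ≡ transpose v u (x j)
        τ-beyond j ℓ<j with queried? π j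
        ... | no _ = refl
        ... | yes qj with find qj
        ...   | t , t∈π , lt = sym (transpose-fixes v u xj≢v xj≢u)
          where
          j≢ℓ : toℕ j ≢ ℓ
          j≢ℓ j≡ℓ = <-irrefl (sym j≡ℓ) ℓ<j
          answer : proj₂ t ≡ x j
          answer = follows-answers fx t∈π lt
          xj≢v : x j ≢ v
          xj≢v xj≡v = unique s t s∈π t∈π c j ls lt (toℕ-start k) j≢ℓ (sym (trans answer xj≡v))
          xj≢u : x j ≢ u
          xj≢u xj≡u = u∉ (subst (_∈ otherAnswers) (trans answer xj≡u) (answer-other t∈π lt j≢ℓ))

        τ-start : τ u x c ≡ transpose v u u
        τ-start = trans (τ-queried u x c (lose s∈π ls))
                        (trans (sym (follows-answers fx s∈π ls)) (sym (transpose-second v u)))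

        G-τ : G (τ u x) ≡ P x u * S x
        G-τ = weight-place u (transpose v u) (transpose-involutive v u) (follows-τ u x) τ-start τ-beyond

      G-τ-weighted : ∀ u x → fresh u otherAnswers * G (τ u x) ≡ fresh u otherAnswers * (S x * P x u)
      G-τ-weighted u x = 𝟙-*-cong (¬? (u ∈? otherAnswers)) λ u∉ → by-cases u∉ (follows? B π x)
        where
        by-cases : u ∉ otherAnswers → Dec (Follows B π x) → G (τ u x) ≡ S x * P x u
        by-cases u∉ (yes fx) = trans (G-τ u∉ fx) (*-comm (P x u) (S x))
        by-cases u∉ (no ¬fx) = trans (weight-off-path (suc r) i z (¬fx ∘ Equivalence.to (follows-τ u x)))
                                     (sym (cong (_* P x u) (weight-off-path r (i ∘ F.suc) (z ∘ F.suc) ¬fx)))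

      #admissible : ℕ
      #admissible = ∑[ u ∈ allFin n ] fresh u otherAnswers

      A : Input n → ℕ
      A x = ∑[ u ∈ allFin n ] (fresh u otherAnswers * P x u)

      #admissible>0 : #admissible > 0
      #admissible>0 = ≤-trans (≤-reflexive (sym (𝟙-yes (¬? (v ∈? otherAnswers)) v-admissible)))
                              (∑-term (allFin n) (λ u → fresh u otherAnswers) (∈-allFin v))

      -- Averaging G over the exchanges τ u with admissible u.
      averaged : #admissible * ∑ Inputs G ≡ ∑[ x ∈ Inputs ] (S x * A x)
      averaged = begin
        #admissible * ∑ Inputs G ≡⟨ ∑-*ʳ (allFin n) (∑ Inputs G) (λ u → fresh u otherAnswers) ⟨
        ∑[ u ∈ allFin n ] (fresh u otherAnswers * ∑ Inputs G)
          ≡⟨ ∑-cong (allFin n) (λ u → cong (fresh u otherAnswers *_) (∑-τ u)) ⟨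
        ∑[ u ∈ allFin n ] (fresh u otherAnswers * ∑[ x ∈ Inputs ] G (τ u x))
          ≡⟨ ∑-cong (allFin n) (λ u → ∑-*ˡ Inputs (fresh u otherAnswers) _) ⟨
        ∑[ u ∈ allFin n ] ∑[ x ∈ Inputs ] (fresh u otherAnswers * G (τ u x))
          ≡⟨ ∑-swap (allFin n) Inputs _ ⟩
        ∑[ x ∈ Inputs ] ∑[ u ∈ allFin n ] (fresh u otherAnswers * G (τ u x))
          ≡⟨ ∑-cong Inputs (λ x → ∑-cong (allFin n) (λ u → G-τ-weighted u x)) ⟩
        ∑[ x ∈ Inputs ] ∑[ u ∈ allFin n ] (fresh u otherAnswers * (S x * P x u))
          ≡⟨ ∑-cong Inputs (λ x → trans (∑-cong (allFin n) (λ u → e (fresh u otherAnswers) (S x) (P x u)))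
                                        (∑-*ˡ (allFin n) (S x) _)) ⟩
        ∑[ x ∈ Inputs ] (S x * A x) ∎
        where
        open ≡-Reasoning
        e : ∀ f s p → f * (s * p) ≡ s * (f * p)
        e = solve-∀
        ∑-τ : ∀ u → ∑[ x ∈ Inputs ] G (τ u x) ≡ ∑ Inputs G
        ∑-τ u = ∑-coordinatewise (λ j → when (¬? (queried? π j)) (transpose v u))
                  (λ j → when-involutive (¬? (queried? π j)) (transpose-involutive v u))
                  G (weight-extensional (suc r) i z)

      result : 18 * ∑ Inputs G ≤ 17 * ∑ Inputs S
      result = *-cancelˡ-≤ #admissible {{>-nonZero #admissible>0}} (begin
        #admissible * (18 * ∑ Inputs G)     ≡⟨ e₁ #admissible (∑ Inputs G) ⟩
        18 * (#admissible * ∑ Inputs G)     ≡⟨ cong (18 *_) averaged ⟩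
        18 * ∑[ x ∈ Inputs ] (S x * A x)    ≤⟨ ∑-averaging Inputs S A #admissible A-bound ⟩
        17 * ∑[ x ∈ Inputs ] (S x * #admissible) ≡⟨ cong (17 *_) (∑-*ʳ Inputs #admissible S) ⟩
        17 * (∑ Inputs S * #admissible)     ≡⟨ e₂ (∑ Inputs S) #admissible ⟩
        #admissible * (17 * ∑ Inputs S)     ∎)
        where
        open ≤-Reasoning
        e₁ : ∀ U g → U * (18 * g) ≡ 18 * (U * g)
        e₁ = solve-∀
        e₂ : ∀ s U → 17 * (s * U) ≡ U * (17 * s)
        e₂ = solve-∀
        A-bound : ∀ x → 18 * A x ≤ 17 * #admissible
        A-bound x = symbol-bound q z₀ (rest x k) otherAnswers otherAnswers≤q q≤ 10≤n

    step-bound : 18 * ∑ Inputs G ≤ 17 * ∑ Inputs S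
    step-bound with queried? π c
    ... | yes qc = let (_ , s∈π , ls) = find qc in Queried.result s∈π ls
    ... | no ¬qc = Unqueried.result ¬qc

  chain : ∀ q → length π ≤ q → 10 * q ≤ n → 10 ≤ n →
          ∀ r (i z : Fin r → Fin n) → (∀ a b → a F.< b → i a F.< i b) → (∀ a → PiUnique B π (toℕ (i a))) →
          18 ^ r * ∑ Inputs (weight r i z) ≤ 17 ^ r * count (follows? B π)
  chain q π≤q q≤ 10≤n zero i z _ _ = ≤-reflexive (cong (1 *_) (sym (count-∑ (follows? B π) Inputs)))
  chain q π≤q q≤ 10≤n (suc r) i z increasing unique = begin
    18 ^ suc r * ∑ Inputs G  ≡⟨ e₁ (18 ^ r) (∑ Inputs G) ⟩
    18 ^ r * (18 * ∑ Inputs G)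
      ≤⟨ *-monoʳ-≤ (18 ^ r) (Step.step-bound q π≤q q≤ 10≤n i z (λ a → increasing F.zero (F.suc a) (s≤s z≤n)) (unique F.zero)) ⟩
    18 ^ r * (17 * ∑ Inputs S) ≡⟨ e₂ (18 ^ r) (∑ Inputs S) ⟩
    17 * (18 ^ r * ∑ Inputs S)
      ≤⟨ *-monoʳ-≤ 17 (chain q π≤q q≤ 10≤n r (i ∘ F.suc) (z ∘ F.suc)
                          (λ a b a<b → increasing (F.suc a) (F.suc b) (s≤s a<b)) (unique ∘ F.suc)) ⟩
    17 * (17 ^ r * count (follows? B π)) ≡⟨ *-assoc 17 (17 ^ r) _ ⟨
    17 ^ suc r * count (follows? B π) ∎
    where
    open ≤-Reasoning
    G = weight (suc r) i z
    S = weight r (i ∘ F.suc) (z ∘ F.suc)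
    e₁ : ∀ p g → 18 * p * g ≡ p * (18 * g)
    e₁ = solve-∀
    e₂ : ∀ p s → p * (17 * s) ≡ 17 * (p * s)
    e₂ = solve-∀

sink-path-walk : ∀ {n} {B : BP n} {v ws} → PathToSink B v ws → Walk B v ws
sink-path-walk (done _) = []
sink-path-walk (step lv p) = step lv (sink-path-walk p)

lemma14 : (n r q : ℕ) → 1 ≤ r → 10 * q ≤ n →
    (B : BP n) → HeightAtMost B q →
    (π : List (Step B)) → SourceSinkPath B π →
    (i : Fin r → Fin n) → (∀ a b → a F.< b → i a F.< i b) →
    (∀ a → PiUnique B π (toℕ (i a))) →
    (z : Fin r → Fin n) → (∀ a → Produces B π (i a) (z a)) →
    18 ^ r * count (target? B π i z) ≤ 17 ^ r * count (follows? B π)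
lemma14 n zero q () q≤ B height π path i increasing unique z produces
lemma14 zero (suc r) q _ _ B _ π _ i _ _ z _ with i F.zero
... | ()
lemma14 (suc n') (suc r) q _ q≤ B height π path i increasing unique z produces =
  ≤-trans (*-monoʳ-≤ (18 ^ suc r) (count-target≤ (suc r) i z))
          (chain q π≤q q≤ 10≤n (suc r) i z increasing unique)
  where
  open Correctness B π
  π≤q : length π ≤ q
  π≤q = height (source B) π (sink-path-walk path)
  -- π produces an output, so it has at least one edge and q ≥ 1.
  π>0 : length π > 0
  π>0 = nonempty (produces F.zero)
    where
    nonempty : ∀ {p} {P : Step B → Set p} {ws} → Any P ws → length ws > 0
    nonempty {ws = _ ∷ _} _ = s≤s z≤n
  10≤n : 10 ≤ suc n'
  10≤n = ≤-trans (*-monoʳ-≤ 10 (≤-trans π>0 π≤q)) q≤
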